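{- Let $M_0=(W_0,R_0,\Vdash_0)$ and $M_1=(W_1,R_1,\Vdash_1)$ be finite Kripke models of the form described in the context, let $P^+,P^-$ be finite sets of propositional variables, let $C_0$ be a cluster of final elements of $M_0$ and $C_1$ a cluster of final elements of $M_1$, and let $w_0\in C_0$, $w_1\in C_1$. If $(M_0,w_0)\xrightarrow[1]{(P^+,P^-)}(M_1,w_1)$, then $C_0$ matches $C_1$.
   Context: Modal formulas use variables, $\bot,\land,\lor,\neg,\to,\Box$ ($\Diamond=\neg\Box\neg$); $v^+(\varphi),v^-(\varphi)$ are the variables occurring positively/negatively ($\neg$ and the antecedent of $\to$ swap polarity, $\Box$, $\land$, $\lor$ preserve it, $v^+(p)=\{p\}$, $v^-(p)=\emptyset$); $d(\varphi)$ is the modal depth. Kripke frames have reflexive transitive $R$. A cluster is an equivalence class of $xR^sy:\iff xRy\wedge yRx$; $y$ is final if $yRz$ implies $zRy$. Each $M_i$ ($i\in\{0,1\}$) is a finite model with a root $x_i$ ($x_iRy$ for all $y$) such that $W_i\setminus\{x_i\}$ is the disjoint union of finitely many (at least one) clusters $C_i^0,\dots,C_i^{j_i}$ of final elements, each element of a cluster seeing exactly the elements of its cluster. A $(P^+,P^-)$-formula is one with $v^\circ(\varphi)\subseteq P^\circ$ for $\circ\in\{+,-\}$. $(M_0,w_0)\xrightarrow[n]{(P^+,P^-)}(M_1,w_1)$ means every $(P^+,P^-)$-formula of modal depth $\le n$ true at $(M_0,w_0)$ is true at $(M_1,w_1)$. A cluster $C_0$ of $M_0$ matches a cluster $C_1$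 of $M_1$ iff for every $u_0\in C_0$ there is $u_1\in C_1$ with $(M_0,u_0)\xrightarrow[0]{(P^+,P^-)}(M_1,u_1)$, and for every $u_1\in C_1$ there is $u_0\in C_0$ with $(M_0,u_0)\xrightarrow[0]{(P^+,P^-)}(M_1,u_1)$. -}

module Defs where

open import Data.Nat using (ℕ; zero; suc; _⊔_; _≤_)
open import Data.Bool using (Bool; true; false; _∧_; _∨_; not)
open import Data.Fin using (Fin)
open import Data.List using (List; []; _∷_; _++_; allFin)
open import Data.List.Membership.Propositional using (_∈_)
open import Data.Product using (_×_; Σ; ∃; ∃-syntax)
open import Relation.Binary.PropositionalEquality using (_≡_)
open import Relation.Nullary using (¬_)

infixr 6 _∧'_
infixr 5 _∨'_
infixr 4 _⇒_

data Fm : Set where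
  var  : ℕ → Fm
  ⊥'   : Fm
  _∧'_ : Fm → Fm → Fm
  _∨'_ : Fm → Fm → Fm
  ¬'_  : Fm → Fm
  _⇒_  : Fm → Fm → Fm
  □_   : Fm → Fm

◇_ : Fm → Fm
◇ φ = ¬' (□ (¬' φ))

mutual
  v⁺ : Fm → List ℕ
  v⁺ (var p)  = p ∷ []
  v⁺ ⊥'       = []
  v⁺ (φ ∧' ψ) = v⁺ φ ++ v⁺ ψ
  v⁺ (φ ∨' ψ) = v⁺ φ ++ v⁺ ψ
  v⁺ (¬' φ)   = v⁻ φ
  v⁺ (φ ⇒ ψ)  = v⁻ φ ++ v⁺ ψ
  v⁺ (□ φ)    = v⁺ φ

  v⁻ : Fm → List ℕ
  v⁻ (var p)  = []
  v⁻ ⊥'       = []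
  v⁻ (φ ∧' ψ) = v⁻ φ ++ v⁻ ψ
  v⁻ (φ ∨' ψ) = v⁻ φ ++ v⁻ ψ
  v⁻ (¬' φ)   = v⁺ φ
  v⁻ (φ ⇒ ψ)  = v⁺ φ ++ v⁻ ψ
  v⁻ (□ φ)    = v⁻ φ

depth : Fm → ℕ
depth (var p)  = zero
depth ⊥'       = zero
depth (φ ∧' ψ) = depth φ ⊔ depth ψ
depth (φ ∨' ψ) = depth φ ⊔ depth ψ
depth (¬' φ)   = depth φ
depth (φ ⇒ ψ)  = depth φ ⊔ depth ψ
depth (□ φ)    = suc (depth φ)

IsPPFm : List ℕ → List ℕ → Fm → Set
IsPPFm P⁺ P⁻ φ = (∀ p → p ∈ v⁺ φ → p ∈ P⁺) × (∀ p → p ∈ v⁻ φ → p ∈ P⁻)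

record Model : Set where
  field
    size : ℕ
    R    : Fin size → Fin size → Bool
    V    : Fin size → ℕ → Bool
open Model public

allB : {A : Set} → (A → Bool) → List A → Bool
allB p []       = true
allB p (a ∷ as) = p a ∧ allB p as

eval : (M : Model) → Fm → Fin (size M) → Bool
eval M (var p)  w = V M w p
eval M ⊥'       w = false
eval M (φ ∧' ψ) w = eval M φ w ∧ eval M ψ w
eval M (φ ∨' ψ) w = eval M φ w ∨ eval M ψ w
eval M (¬' φ)   w = not (eval M φ w)
eval M (φ ⇒ ψ)  w = not (eval M φ w) ∨ eval M ψ w
eval M (□ φ)    w = allB (λ u → not (R M w u) ∨ eval M φ u) (allFin (size M))

_⊨_at_ : (M : Model) → Fm → Fin (size M) → Set
M ⊨ φ at w = eval M φ w ≡ true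

Rel : (M : Model) → Fin (size M) → Fin (size M) → Set
Rel M x y = R M x y ≡ true

Rs : (M : Model) → Fin (size M) → Fin (size M) → Set
Rs M x y = Rel M x y × Rel M y x

Final : (M : Model) → Fin (size M) → Set
Final M y = ∀ z → Rel M y z → Rel M z y

IsCluster : (M : Model) → (Fin (size M) → Set) → Set
IsCluster M C = ∃[ w ] (∀ u → (C u → Rs M w u) × (Rs M w u → C u))

-- The shape of models in the context: R reflexive and transitive, x is a
-- root, and W ∖ {x} is a nonempty disjoint union of clusters of final
-- elements where each element of a cluster sees exactly its own cluster,
-- i.e. every y ≠ x sees exactly the elements of its R^s-class (which then
-- are all final and ≠ x).
IsSpecialModel : (M : Model) → Fin (size M) → Set
IsSpecialModel M x =
    (∀ y → Rel M y y)
  × (∀ y z u → Rel M y z → Rel M z u → Rel M y u)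
  × (∀ y → Rel M x y)
  × (∃[ y ] ¬ (y ≡ x))
  × (∀ y z → ¬ (y ≡ x) → Rel M y z → Rs M y z)
  × (∀ y → ¬ (y ≡ x) → ¬ Rel M y x)

Pres : ℕ → List ℕ → List ℕ → (M₀ : Model) → Fin (size M₀)
     → (M₁ : Model) → Fin (size M₁) → Set
Pres n P⁺ P⁻ M₀ w₀ M₁ w₁ =
  ∀ φ → IsPPFm P⁺ P⁻ φ → depth φ ≤ n → M₀ ⊨ φ at w₀ → M₁ ⊨ φ at w₁

Matches : List ℕ → List ℕ → (M₀ : Model) → (Fin (size M₀) → Set)
        → (M₁ : Model) → (Fin (size M₁) → Set) → Set
Matches P⁺ P⁻ M₀ C₀ M₁ C₁ =
    (∀ u₀ → C₀ u₀ → ∃[ u₁ ] (C₁ u₁ × Pres 0 P⁺ P⁻ M₀ u₀ M₁ u₁))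
  × (∀ u₁ → C₁ u₁ → ∃[ u₀ ] (C₀ u₀ × Pres 0 P⁺ P⁻ M₀ u₀ M₁ u₁))

-- For u₀ ∈ C₀ let χ be the conjunction of the (P⁺,P⁻)-literals true at u₀
-- (p for p ∈ P⁺ true at u₀, ¬p for p ∈ P⁻ false at u₀).  Since w₀ R u₀, the
-- depth-1 (P⁺,P⁻)-formula ◇χ holds at w₀, hence at w₁; a witness u₁ lies in
-- C₁ because w₁ is final, and as u₁ satisfies χ and depth-0 formulas are
-- monotone in the literals, u₁ inherits every depth-0 (P⁺,P⁻)-formula of u₀.
-- The converse half is the same argument with the models exchanged: by
-- negation, (M₀,w₀) →ₙ^(P⁺,P⁻) (M₁,w₁) iff (M₁,w₁) →ₙ^(P⁻,P⁺) (M₀,w₀).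
module Submission where

open import Defs
open import Data.Bool using (Bool; true; false; _∧_; _∨_; not; if_then_else_; _≤_; b≤b; f≤t)
open import Data.Bool.Properties
  using (≤-minimum; ≤-maximum; ∧-zeroʳ; ∧-conicalˡ; ∧-conicalʳ; ∨-conicalˡ; ∨-conicalʳ; not-injective)
open import Data.Fin using (Fin)
open import Data.List using (List; []; _∷_; _++_; foldr; map; allFin)
open import Data.List.Membership.Propositional using (_∈_)
open import Data.List.Membership.Propositional.Properties using (∈-++⁺ˡ; ∈-++⁺ʳ; ∈-++⁻; ∈-allFin)
open import Data.List.Relation.Unary.All using (All; []; _∷_; tabulate; lookup)
open import Data.List.Relation.Unary.All.Properties using (++⁺; ++⁻; map⁺; map⁻)
open import Data.List.Relation.Unary.Any using (here; there)
open import Data.Nat using (ℕ; _⊔_; z≤n; s≤s) renaming (_≤_ to _≤ℕ_)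
open import Data.Nat.Properties using (⊔-lub; m⊔n≤o⇒m≤o; m⊔n≤o⇒n≤o)
open import Data.Product using (_×_; _,_; proj₁; proj₂; ∃-syntax; swap; map₂)
open import Data.Sum using ([_,_]′)
open import Relation.Binary.PropositionalEquality using (_≡_; refl; trans; cong; cong₂; subst)

private
  variable
    M M₀ M₁ : Model
    P P⁺ P⁻ : List ℕ
    xs ys : List ℕ
    φ ψ : Fm
    φs : List Fm
    n : ℕ
    a a′ b b′ : Bool

∧-mono-≤ : a ≤ a′ → b ≤ b′ → a ∧ b ≤ a′ ∧ b′
∧-mono-≤ f≤t _ = ≤-minimum _
∧-mono-≤ {a = false} b≤b _ = b≤b
∧-mono-≤ {a = true} b≤b b≤b′ = b≤b′

∨-mono-≤ : a ≤ a′ → b ≤ b′ → a ∨ b ≤ a′ ∨ b′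
∨-mono-≤ f≤t _ = ≤-maximum _
∨-mono-≤ {a = true} b≤b _ = b≤b
∨-mono-≤ {a = false} b≤b b≤b′ = b≤b′

not-antimono-≤ : a ≤ b → not b ≤ not a
not-antimono-≤ f≤t = f≤t
not-antimono-≤ b≤b = b≤b

≤-true : a ≤ b → a ≡ true → b ≡ true
≤-true b≤b refl = refl
≤-true f≤t _ = refl

≤-from-true : (a ≡ true → b ≡ true) → a ≤ b
≤-from-true {false} _ = ≤-minimum _
≤-from-true {true} f with f refl
... | refl = b≤b

not-contraposition : (not a ≡ true → not b ≡ true) → b ≡ true → a ≡ true
not-contraposition {true} _ _ = refl
not-contraposition {false} f refl = f refl

allB-false⁺ : {A : Set} {p : A → Bool} {x : A} {xs : List A}
            → x ∈ xs → p x ≡ false → allB p xs ≡ false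
allB-false⁺ (here refl) px rewrite px = refl
allB-false⁺ {p = p} {xs = y ∷ _} (there x∈) px =
  trans (cong (p y ∧_) (allB-false⁺ x∈ px)) (∧-zeroʳ (p y))

allB-false⁻ : {A : Set} {p : A → Bool} {xs : List A}
            → allB p xs ≡ false → ∃[ x ] p x ≡ false
allB-false⁻ {xs = []} ()
allB-false⁻ {p = p} {xs = x ∷ xs} all≡false with p x in px
... | false = x , px
... | true = allB-false⁻ {xs = xs} all≡false

◇-intro : {w u : Fin (size M)} → Rel M w u → M ⊨ φ at u → M ⊨ ◇ φ at w
◇-intro {u = u} wRu u⊨φ =
  cong not (allB-false⁺ (∈-allFin u) (cong₂ (λ r e → not r ∨ not e) wRu u⊨φ))

◇-elim : {w : Fin (size M)} → M ⊨ ◇ φ at w → ∃[ u ] (Rel M w u × M ⊨ φ at u)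
◇-elim {M = M} {w = w} w⊨◇φ
  with allB-false⁻ {xs = allFin (size M)} (not-injective w⊨◇φ)
... | u , e = u , not-injective (∨-conicalˡ (not (R M w u)) _ e)
                , not-injective (∨-conicalʳ (not (R M w u)) _ e)

infix 4 _⊆_
_⊆_ : List ℕ → List ℕ → Set
xs ⊆ ys = ∀ p → p ∈ xs → p ∈ ys

++-⊆⁺ : xs ⊆ P → ys ⊆ P → xs ++ ys ⊆ P
++-⊆⁺ {xs = xs} xs⊆P ys⊆P p p∈ = [ xs⊆P p , ys⊆P p ]′ (∈-++⁻ xs p∈)

++-⊆⁻ : ∀ xs → xs ++ ys ⊆ P → xs ⊆ P × ys ⊆ P
++-⊆⁻ xs ⊆P = (λ p p∈ → ⊆P p (∈-++⁺ˡ p∈)) , (λ p p∈ → ⊆P p (∈-++⁺ʳ xs p∈))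

IsPPFm-∧⁻ : ∀ φ ψ → IsPPFm P⁺ P⁻ (φ ∧' ψ) → IsPPFm P⁺ P⁻ φ × IsPPFm P⁺ P⁻ ψ
IsPPFm-∧⁻ φ _ (⊆P⁺ , ⊆P⁻) with ++-⊆⁻ (v⁺ φ) ⊆P⁺ | ++-⊆⁻ (v⁻ φ) ⊆P⁻
... | φ⊆P⁺ , ψ⊆P⁺ | φ⊆P⁻ , ψ⊆P⁻ = (φ⊆P⁺ , φ⊆P⁻) , (ψ⊆P⁺ , ψ⊆P⁻)

IsPPFm-∨⁻ : ∀ φ ψ → IsPPFm P⁺ P⁻ (φ ∨' ψ) → IsPPFm P⁺ P⁻ φ × IsPPFm P⁺ P⁻ ψ
IsPPFm-∨⁻ = IsPPFm-∧⁻

IsPPFm-⇒⁻ : ∀ φ ψ → IsPPFm P⁺ P⁻ (φ ⇒ ψ) → IsPPFm P⁻ P⁺ φ × IsPPFm P⁺ P⁻ ψ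
IsPPFm-⇒⁻ φ _ (⊆P⁺ , ⊆P⁻) with ++-⊆⁻ (v⁻ φ) ⊆P⁺ | ++-⊆⁻ (v⁺ φ) ⊆P⁻
... | φ⊆P⁺ , ψ⊆P⁺ | φ⊆P⁻ , ψ⊆P⁻ = (φ⊆P⁻ , φ⊆P⁺) , (ψ⊆P⁺ , ψ⊆P⁻)

⊔-≤⁻ : ∀ m {n o} → m ⊔ n ≤ℕ o → m ≤ℕ o × n ≤ℕ o
⊔-≤⁻ m {n} m⊔n≤o = m⊔n≤o⇒m≤o m n m⊔n≤o , m⊔n≤o⇒n≤o m n m⊔n≤o

VarPres : List ℕ → List ℕ → (M₀ : Model) → Fin (size M₀)
        → (M₁ : Model) → Fin (size M₁) → Set
VarPres P⁺ P⁻ M₀ u₀ M₁ u₁ =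
    (∀ p → p ∈ P⁺ → V M₀ u₀ p ≡ true → V M₁ u₁ p ≡ true)
  × (∀ p → p ∈ P⁻ → V M₁ u₁ p ≡ true → V M₀ u₀ p ≡ true)

VarPres⇒eval-≤ : {u₀ : Fin (size M₀)} {u₁ : Fin (size M₁)}
               → VarPres P⁺ P⁻ M₀ u₀ M₁ u₁ → ∀ φ → IsPPFm P⁺ P⁻ φ → depth φ ≤ℕ 0
               → eval M₀ φ u₀ ≤ eval M₁ φ u₁
VarPres⇒eval-≤ (pres⁺ , _) (var p) (⊆P⁺ , _) _ = ≤-from-true (pres⁺ p (⊆P⁺ p (here refl)))
VarPres⇒eval-≤ _ ⊥' _ _ = b≤b
VarPres⇒eval-≤ vp (φ ∧' ψ) pp d with IsPPFm-∧⁻ φ ψ pp | ⊔-≤⁻ (depth φ) d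
... | ppφ , ppψ | dφ , dψ = ∧-mono-≤ (VarPres⇒eval-≤ vp φ ppφ dφ) (VarPres⇒eval-≤ vp ψ ppψ dψ)
VarPres⇒eval-≤ vp (φ ∨' ψ) pp d with IsPPFm-∨⁻ φ ψ pp | ⊔-≤⁻ (depth φ) d
... | ppφ , ppψ | dφ , dψ = ∨-mono-≤ (VarPres⇒eval-≤ vp φ ppφ dφ) (VarPres⇒eval-≤ vp ψ ppψ dψ)
VarPres⇒eval-≤ vp (¬' φ) pp d = not-antimono-≤ (VarPres⇒eval-≤ (swap vp) φ (swap pp) d)
VarPres⇒eval-≤ vp (φ ⇒ ψ) pp d with IsPPFm-⇒⁻ φ ψ pp | ⊔-≤⁻ (depth φ) d
... | ppφ , ppψ | dφ , dψ =
  ∨-mono-≤ (not-antimono-≤ (VarPres⇒eval-≤ (swap vp) φ ppφ dφ)) (VarPres⇒eval-≤ vp ψ ppψ dψ)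
VarPres⇒eval-≤ _ (□ _) _ ()

VarPres⇒Pres₀ : {u₀ : Fin (size M₀)} {u₁ : Fin (size M₁)}
              → VarPres P⁺ P⁻ M₀ u₀ M₁ u₁ → Pres 0 P⁺ P⁻ M₀ u₀ M₁ u₁
VarPres⇒Pres₀ vp φ pp d = ≤-true (VarPres⇒eval-≤ vp φ pp d)

Pres-flip : {w₀ : Fin (size M₀)} {w₁ : Fin (size M₁)}
          → Pres n P⁺ P⁻ M₀ w₀ M₁ w₁ → Pres n P⁻ P⁺ M₁ w₁ M₀ w₀
Pres-flip pres φ pp d = not-contraposition (pres (¬' φ) (swap pp) d)

⊤' : Fm
⊤' = ¬' ⊥'

⋀ : List Fm → Fm
⋀ = foldr _∧'_ ⊤'

⋀-depth : All (λ φ → depth φ ≤ℕ n) φs → depth (⋀ φs) ≤ℕ n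
⋀-depth [] = z≤n
⋀-depth (d ∷ ds) = ⊔-lub d (⋀-depth ds)

⋀-IsPPFm : All (IsPPFm P⁺ P⁻) φs → IsPPFm P⁺ P⁻ (⋀ φs)
⋀-IsPPFm [] = (λ _ ()) , (λ _ ())
⋀-IsPPFm ((φ⊆P⁺ , φ⊆P⁻) ∷ pps) with ⋀-IsPPFm pps
... | ⋀⊆P⁺ , ⋀⊆P⁻ = ++-⊆⁺ φ⊆P⁺ ⋀⊆P⁺ , ++-⊆⁺ φ⊆P⁻ ⋀⊆P⁻

⋀-true⁺ : {w : Fin (size M)} → All (λ φ → M ⊨ φ at w) φs → M ⊨ ⋀ φs at w
⋀-true⁺ [] = refl
⋀-true⁺ (w⊨φ ∷ w⊨φs) rewrite w⊨φ = ⋀-true⁺ w⊨φs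

⋀-true⁻ : {w : Fin (size M)} → M ⊨ ⋀ φs at w → All (λ φ → M ⊨ φ at w) φs
⋀-true⁻ {φs = []} _ = []
⋀-true⁻ {φs = φ ∷ φs} w⊨⋀ = ∧-conicalˡ _ _ w⊨⋀ ∷ ⋀-true⁻ (∧-conicalʳ _ _ w⊨⋀)

module _ (M : Model) (u : Fin (size M)) where

  posLit : ℕ → Fm
  posLit p = if V M u p then var p else ⊤'

  negLit : ℕ → Fm
  negLit p = if V M u p then ⊤' else ¬' var p

  literals : List ℕ → List ℕ → List Fm
  literals P⁺ P⁻ = map posLit P⁺ ++ map negLit P⁻

  All-literals : ∀ P⁺ P⁻ (Q : Fm → Set)
               → (∀ {p} → p ∈ P⁺ → Q (posLit p)) → (∀ {p} → p ∈ P⁻ → Q (negLit p))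
               → All Q (literals P⁺ P⁻)
  All-literals _ _ Q Qpos Qneg = ++⁺ (map⁺ (tabulate Qpos)) (map⁺ (tabulate Qneg))

  charFm : List ℕ → List ℕ → Fm
  charFm P⁺ P⁻ = ⋀ (literals P⁺ P⁻)

  charFm-depth : ∀ P⁺ P⁻ → depth (charFm P⁺ P⁻) ≤ℕ 0
  charFm-depth P⁺ P⁻ =
    ⋀-depth (All-literals P⁺ P⁻ _ (λ {p} _ → posLit-depth p) (λ {p} _ → negLit-depth p))
    where
    posLit-depth : ∀ p → depth (posLit p) ≤ℕ 0
    posLit-depth p with V M u p
    ... | true = z≤n
    ... | false = z≤n
    negLit-depth : ∀ p → depth (negLit p) ≤ℕ 0
    negLit-depth p with V M u p
    ... | true = z≤n
    ... | false = z≤n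

  charFm-IsPPFm : ∀ P⁺ P⁻ → IsPPFm P⁺ P⁻ (charFm P⁺ P⁻)
  charFm-IsPPFm P⁺ P⁻ = ⋀-IsPPFm (All-literals P⁺ P⁻ _ posLit-IsPPFm negLit-IsPPFm)
    where
    posLit-IsPPFm : ∀ {p} → p ∈ P⁺ → IsPPFm P⁺ P⁻ (posLit p)
    posLit-IsPPFm {p} p∈ with V M u p
    ... | true = (λ { _ (here refl) → p∈ }) , (λ _ ())
    ... | false = (λ _ ()) , (λ _ ())
    negLit-IsPPFm : ∀ {p} → p ∈ P⁻ → IsPPFm P⁺ P⁻ (negLit p)
    negLit-IsPPFm {p} p∈ with V M u p
    ... | true = (λ _ ()) , (λ _ ())
    ... | false = (λ _ ()) , (λ { _ (here refl) → p∈ })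

  charFm-true : ∀ P⁺ P⁻ → M ⊨ charFm P⁺ P⁻ at u
  charFm-true P⁺ P⁻ =
    ⋀-true⁺ (All-literals P⁺ P⁻ _ (λ {p} _ → posLit-true p) (λ {p} _ → negLit-true p))
    where
    posLit-true : ∀ p → M ⊨ posLit p at u
    posLit-true p with V M u p in u⊨p
    ... | true = u⊨p
    ... | false = refl
    negLit-true : ∀ p → M ⊨ negLit p at u
    negLit-true p with V M u p in u⊨p
    ... | true = refl
    ... | false = cong not u⊨p

  charFm-VarPres : ∀ P⁺ P⁻ N v → N ⊨ charFm P⁺ P⁻ at v → VarPres P⁺ P⁻ M u N v
  charFm-VarPres P⁺ _ N v v⊨χ with ++⁻ (map posLit P⁺) (⋀-true⁻ v⊨χ)
  ... | v⊨pos , v⊨neg =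
    (λ p p∈ → posLit-VarPres (lookup (map⁻ v⊨pos) p∈)) ,
    (λ p p∈ → negLit-VarPres (lookup (map⁻ v⊨neg) p∈))
    where
    posLit-VarPres : ∀ {p} → N ⊨ posLit p at v → V M u p ≡ true → V N v p ≡ true
    posLit-VarPres {p} v⊨lit u⊨p rewrite u⊨p = v⊨lit
    negLit-VarPres : ∀ {p} → N ⊨ negLit p at v → V N v p ≡ true → V M u p ≡ true
    negLit-VarPres {p} v⊨lit v⊨p with V M u p
    ... | true = refl
    ... | false = subst (λ b → not b ≡ true) v⊨p v⊨lit

Pres₁-forth : {w₀ u₀ : Fin (size M₀)} {w₁ : Fin (size M₁)}
            → Pres 1 P⁺ P⁻ M₀ w₀ M₁ w₁ → Rel M₀ w₀ u₀
            → ∃[ u₁ ] (Rel M₁ w₁ u₁ × Pres 0 P⁺ P⁻ M₀ u₀ M₁ u₁)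
Pres₁-forth {M₀} {M₁} {P⁺} {P⁻} {w₀} {u₀} pres w₀Ru₀ =
  let u₁ , w₁Ru₁ , u₁⊨χ = ◇-elim {M = M₁} {φ = χ} (pres (◇ χ) χ-IsPPFm (s≤s χ-depth) w₀⊨◇χ)
  in u₁ , w₁Ru₁ , VarPres⇒Pres₀ (charFm-VarPres M₀ u₀ P⁺ P⁻ M₁ u₁ u₁⊨χ)
  where
  χ : Fm
  χ = charFm M₀ u₀ P⁺ P⁻
  χ-IsPPFm : IsPPFm P⁺ P⁻ χ
  χ-IsPPFm = charFm-IsPPFm M₀ u₀ P⁺ P⁻
  χ-depth : depth χ ≤ℕ 0
  χ-depth = charFm-depth M₀ u₀ P⁺ P⁻
  w₀⊨◇χ : M₀ ⊨ ◇ χ at w₀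
  w₀⊨◇χ = ◇-intro {M = M₀} {φ = χ} w₀Ru₀ (charFm-true M₀ u₀ P⁺ P⁻)

IsTransitive : Model → Set
IsTransitive M = ∀ x y z → Rel M x y → Rel M y z → Rel M x z

cluster-connected : {C : Fin (size M) → Set} {w u : Fin (size M)}
                  → IsTransitive M → IsCluster M C → C w → C u → Rel M w u
cluster-connected {w = w} {u} trans-R (c , K) w∈C u∈C =
  trans-R w c u (proj₂ (proj₁ (K w) w∈C)) (proj₁ (proj₁ (K u) u∈C))

cluster-closed : {C : Fin (size M) → Set} {w u : Fin (size M)}
               → IsTransitive M → IsCluster M C → C w → Final M w → Rel M w u → C u
cluster-closed {w = w} {u} trans-R (c , K) w∈C w-final wRu with proj₁ (K w) w∈C
... | cRw , wRc = proj₂ (K u) (trans-R c w u cRw wRu , trans-R u w c (w-final u wRu) wRc)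

Pres₁-cluster-forth : {C₀ : Fin (size M₀) → Set} {C₁ : Fin (size M₁) → Set}
                      {w₀ : Fin (size M₀)} {w₁ : Fin (size M₁)}
                    → IsTransitive M₀ → IsTransitive M₁ → IsCluster M₀ C₀ → IsCluster M₁ C₁
                    → C₀ w₀ → C₁ w₁ → Final M₁ w₁ → Pres 1 P⁺ P⁻ M₀ w₀ M₁ w₁
                    → ∀ u₀ → C₀ u₀ → ∃[ u₁ ] (C₁ u₁ × Pres 0 P⁺ P⁻ M₀ u₀ M₁ u₁)
Pres₁-cluster-forth {M₀ = M₀} {M₁ = M₁} trans₀ trans₁ K₀ K₁ w₀∈C₀ w₁∈C₁ w₁-final pres u₀ u₀∈C₀ =
  let u₁ , w₁Ru₁ , pres₀ = Pres₁-forth {M₀ = M₀} {M₁ = M₁} {u₀ = u₀} pres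
                             (cluster-connected {M = M₀} trans₀ K₀ w₀∈C₀ u₀∈C₀)
  in u₁ , cluster-closed {M = M₁} trans₁ K₁ w₁∈C₁ w₁-final w₁Ru₁ , pres₀

lemma4p2 : (M₀ M₁ : Model) (x₀ : Fin (size M₀)) (x₁ : Fin (size M₁))
    → IsSpecialModel M₀ x₀ → IsSpecialModel M₁ x₁
    → (P⁺ P⁻ : List ℕ)
    → (C₀ : Fin (size M₀) → Set) (C₁ : Fin (size M₁) → Set)
    → IsCluster M₀ C₀ → (∀ u → C₀ u → Final M₀ u)
    → IsCluster M₁ C₁ → (∀ u → C₁ u → Final M₁ u)
    → (w₀ : Fin (size M₀)) (w₁ : Fin (size M₁)) → C₀ w₀ → C₁ w₁
    → Pres 1 P⁺ P⁻ M₀ w₀ M₁ w₁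
    → Matches P⁺ P⁻ M₀ C₀ M₁ C₁
lemma4p2 M₀ M₁ x₀ x₁ S₀ S₁ P⁺ P⁻ C₀ C₁ K₀ F₀ K₁ F₁ w₀ w₁ w₀∈C₀ w₁∈C₁ pres =
    Pres₁-cluster-forth trans₀ trans₁ K₀ K₁ w₀∈C₀ w₁∈C₁ (F₁ w₁ w₁∈C₁) pres
  , λ u₁ u₁∈C₁ → map₂ (map₂ Pres-flip)
      (Pres₁-cluster-forth trans₁ trans₀ K₁ K₀ w₁∈C₁ w₀∈C₀ (F₀ w₀ w₀∈C₀) (Pres-flip pres) u₁ u₁∈C₁)
  where
  trans₀ : IsTransitive M₀
  trans₀ = proj₁ (proj₂ S₀)
  trans₁ : IsTransitive M₁
  trans₁ = proj₁ (proj₂ S₁)
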